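{- For any $s,t\in V$, the maximum number of pairwise edge-disjoint paths from $s$ to $t$ in $G_{\mathrm{new}}$ equals $\min(k,\lambda(s,t))$.
   Context: Let $G=(V,E)$ be a simple directed graph with $n$ vertices and $m$ edges, and $k$ a positive integer. For $s,t\in V$, $\lambda(s,t)$ denotes the maximum number of pairwise edge-disjoint paths from $s$ to $t$ in $G$. The directed multigraph $G_{\mathrm{new}}$ is built as follows: its vertex set is $V$ together with two new vertices $v_{\mathrm{in}},v_{\mathrm{out}}$ for each $v\in V$; each edge $(u,v)\in E$ is replaced by an edge $(u_{\mathrm{out}},v_{\mathrm{in}})$; and for each $v\in V$ we add $k$ parallel edges from $v$ to $v_{\mathrm{out}}$ and $k$ parallel edges from $v_{\mathrm{in}}$ to $v$. -}

module Defs where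

open import Data.Nat using (ℕ; _⊓_; _≤_)
open import Data.Fin using (Fin)
open import Data.List using (List; []; _∷_; length; lookup; map; _++_; replicate; concatMap; allFin)
open import Data.Product using (_×_; _,_; proj₁; proj₂; Σ)
open import Relation.Binary.PropositionalEquality using (_≡_)
open import Relation.Nullary using (¬_)
open import Data.List.Relation.Unary.All using (All)
open import Data.List.Relation.Unary.AllPairs using (AllPairs)
open import Data.List.Relation.Unary.Unique.Propositional using (Unique)
open import Data.List.Relation.Binary.Disjoint.Propositional using (Disjoint)

-- Directed multigraphs: a vertex type V and a list of edges (u , v).
-- Parallel edges are distinct list entries, identified by their index
-- in the list (an element of Fin (length es)).

EdgeList : Set → Set
EdgeList V = List (V × V)

EdgeId : {V : Set} → EdgeList V → Set
EdgeId es = Fin (length es)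

tail-of : {V : Set} (es : EdgeList V) → EdgeId es → V
tail-of es i = proj₁ (lookup es i)

head-of : {V : Set} (es : EdgeList V) → EdgeId es → V
head-of es i = proj₂ (lookup es i)

data IsWalk {V : Set} (es : EdgeList V) : V → V → List (EdgeId es) → Set where
  walk-nil  : ∀ {v} → IsWalk es v v []
  walk-cons : ∀ {s t i is} → tail-of es i ≡ s →
              IsWalk es (head-of es i) t is → IsWalk es s t (i ∷ is)

walkVertices : {V : Set} (es : EdgeList V) → V → List (EdgeId es) → List V
walkVertices es s is = s ∷ map (head-of es) is

IsPath : {V : Set} (es : EdgeList V) → V → V → List (EdgeId es) → Set
IsPath es s t is = IsWalk es s t is × Unique (walkVertices es s is)

EdgeDisjointPaths : {V : Set} (es : EdgeList V) → V → V → List (List (EdgeId es)) → Set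
EdgeDisjointPaths es s t ps = All (IsPath es s t) ps × AllPairs Disjoint ps

IsMaxEdgeDisjoint : {V : Set} (es : EdgeList V) → V → V → ℕ → Set
IsMaxEdgeDisjoint es s t c =
  Σ (List (List (EdgeId es))) (λ ps → EdgeDisjointPaths es s t ps × length ps ≡ c)
  × (∀ ps → EdgeDisjointPaths es s t ps → length ps ≤ c)

IsSimple : {n : ℕ} → EdgeList (Fin n) → Set
IsSimple es = Unique es × All (λ e → ¬ (proj₁ e ≡ proj₂ e)) es

data NewV (n : ℕ) : Set where
  orig : Fin n → NewV n
  vin  : Fin n → NewV n
  vout : Fin n → NewV n

newEdges : (n k : ℕ) → EdgeList (Fin n) → EdgeList (NewV n)
newEdges n k es =
  map (λ e → (vout (proj₁ e) , vin (proj₂ e))) es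
  ++ concatMap (λ v → replicate k (orig v , vout v) ++ replicate k (vin v , orig v)) (allFin n)

-- A path of G_new from s to t necessarily runs s → s_out → v_in → v → v_out → ⋯ → t, so it is the
-- blow-up of a path of G, and deleting its auxiliary edges projects it back to a path of G. Each
-- edge of G has a single copy in G_new, so projection keeps paths edge-disjoint: there are at most
-- λ(s,t) disjoint paths in G_new, and at most k because each one starts with one of the k parallel
-- edges s → s_out. Conversely, blowing up min(k, λ(s,t)) disjoint paths of G, the a-th of them
-- through the a-th copies of the parallel edges, gives as many disjoint paths in G_new.

module Submission where

open import Defs
open import Data.Nat using (ℕ; zero; suc; pred; _+_; _⊓_; _≤_)
open import Data.Nat.Properties using (⊓-glb)
open import Data.Fin using (Fin; zero; suc; cast; join)
open import Data.Fin.Properties using (cast-involutive; cast-is-id; +↔⊎; injective⇒≤)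
open import Data.List
  using (List; []; _∷_; length; lookup; map; _++_; replicate; concatMap; tabulate; allFin; zipWith)
open import Data.List.Properties
  using (length-map; length-++; length-replicate; lookup-replicate; length-zipWith; length-tabulate)
open import Data.List.Membership.Propositional using (_∈_)
open import Data.List.Membership.Propositional.Properties using (∈-lookup)
open import Data.List.Relation.Unary.All as All using (All; []; _∷_)
import Data.List.Relation.Unary.All.Properties as All
open import Data.List.Relation.Unary.AllPairs as AllPairs using (AllPairs; []; _∷_)
import Data.List.Relation.Unary.AllPairs.Properties as AllPairs
open import Data.List.Relation.Unary.Any using (here; there)
open import Data.List.Relation.Unary.Unique.Propositional using (Unique)
import Data.List.Relation.Unary.Unique.Propositional.Properties as Unique
open import Data.List.Relation.Binary.Disjoint.Propositional using (Disjoint)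
open import Data.List.Relation.Binary.Sublist.Propositional using (_⊆_; []; _∷_; _∷ʳ_)
open import Data.List.Relation.Binary.Sublist.Propositional.Properties using (All-resp-⊆)
open import Data.Product using (_×_; _,_; proj₁; proj₂; ∃)
import Data.Product as Product
open import Data.Sum using (_⊎_; inj₁; inj₂; [_,_]′)
open import Data.Sum.Function.Propositional using (_⊎-↔_)
open import Data.Empty using (⊥; ⊥-elim)
open import Function using (id)
open import Function.Bundles using (_↔_; Inverse; mk↔ₛ′)
open import Function.Definitions using (Injective)
open import Function.Properties.Inverse using (↔-refl; ↔-sym; ↔-trans)
open import Relation.Binary.PropositionalEquality using (_≡_; _≢_; refl; sym; trans; cong; subst)
open import Relation.Nullary using (¬_)

private variable
  A B C I J : Set

record Enumeration (xs : List A) (f : I → A) : Set where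
  field
    indexing     : I ↔ Fin (length xs)
  open Inverse indexing public using () renaming (to to index; from to label)
  field
    lookup-index : ∀ i → lookup xs (index i) ≡ f i

  label-index : ∀ i → label (index i) ≡ i
  label-index = Inverse.strictlyInverseʳ indexing

  index-label : ∀ e → index (label e) ≡ e
  index-label = Inverse.strictlyInverseˡ indexing

  lookup-label : ∀ e → lookup xs e ≡ f (label e)
  lookup-label e = trans (cong (lookup xs) (sym (index-label e))) (lookup-index (label e))

cast↔ : {m n : ℕ} → m ≡ n → Fin m ↔ Fin n
cast↔ eq = mk↔ₛ′ (cast eq) (cast (sym eq)) (cast-involutive eq (sym eq)) (cast-involutive (sym eq) eq)

lookup-enum : (xs : List A) → Enumeration xs (lookup xs)
lookup-enum xs = record { indexing = ↔-refl ; lookup-index = λ _ → refl }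

reindex : {xs : List A} {f : I → A} {g : J → A} (σ : I ↔ J) →
          (∀ i → g (Inverse.to σ i) ≡ f i) → Enumeration xs g → Enumeration xs f
reindex σ g∘σ≗f e = record
  { indexing     = ↔-trans σ (Enumeration.indexing e)
  ; lookup-index = λ i → trans (Enumeration.lookup-index e (Inverse.to σ i)) (g∘σ≗f i) }

lookup-map-cast : (g : A → B) (xs : List A) .(eq : length xs ≡ length (map g xs)) (i : Fin (length xs)) →
                  lookup (map g xs) (cast eq i) ≡ g (lookup xs i)
lookup-map-cast g (x ∷ xs) eq zero    = refl
lookup-map-cast g (x ∷ xs) eq (suc i) = lookup-map-cast g xs (cong pred eq) i

lookup-++-join : (xs ys : List A) .(eq : length xs + length ys ≡ length (xs ++ ys))
                 (s : Fin (length xs) ⊎ Fin (length ys)) →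
                 lookup (xs ++ ys) (cast eq (join _ _ s)) ≡ [ lookup xs , lookup ys ]′ s
lookup-++-join []       ys eq (inj₂ j)       = cong (lookup ys) (cast-is-id _ j)
lookup-++-join (x ∷ xs) ys eq (inj₁ zero)    = refl
lookup-++-join (x ∷ xs) ys eq (inj₁ (suc i)) = lookup-++-join xs ys (cong pred eq) (inj₁ i)
lookup-++-join (x ∷ xs) ys eq (inj₂ j)       = lookup-++-join xs ys (cong pred eq) (inj₂ j)

map-enum : (g : A → B) (xs : List A) → Enumeration (map g xs) (λ i → g (lookup xs i))
map-enum g xs = reindex (cast↔ (sym (length-map g xs))) (lookup-map-cast g xs _) (lookup-enum (map g xs))

replicate-enum : (k : ℕ) (a : A) → Enumeration (replicate k a) (λ (_ : Fin k) → a)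
replicate-enum k a =
  reindex (cast↔ (sym (length-replicate k))) (lookup-replicate k a) (lookup-enum (replicate k a))

++-enum : {xs ys : List A} {f : I → A} {g : J → A} →
          Enumeration xs f → Enumeration ys g → Enumeration (xs ++ ys) [ f , g ]′
++-enum {xs = xs} {ys} ex ey =
  reindex (Enumeration.indexing ex ⊎-↔ Enumeration.indexing ey)
          (λ { (inj₁ i) → Enumeration.lookup-index ex i ; (inj₂ j) → Enumeration.lookup-index ey j })
          (reindex (↔-trans (↔-sym +↔⊎) (cast↔ (sym (length-++ xs))))
                   (lookup-++-join xs ys _) (lookup-enum (xs ++ ys)))

suc×↔⊎ : {n : ℕ} → (Fin (suc n) × J) ↔ (J ⊎ (Fin n × J))
suc×↔⊎ = mk↔ₛ′ to from (λ { (inj₁ j) → refl ; (inj₂ (i , j)) → refl })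
                       (λ { (zero , j) → refl ; (suc i , j) → refl })
  where
    to : _ → _
    to (zero  , j) = inj₁ j
    to (suc i , j) = inj₂ (i , j)
    from : _ → _
    from (inj₁ j)       = zero , j
    from (inj₂ (i , j)) = suc i , j

concatMap-tabulate-enum : {n : ℕ} (h : Fin n → B) (g : B → List A) {f : B → J → A} →
  (∀ b → Enumeration (g b) (f b)) →
  Enumeration (concatMap g (tabulate h)) (λ (p : Fin n × J) → f (h (proj₁ p)) (proj₂ p))
concatMap-tabulate-enum {n = zero} h g eg = record
  { indexing = mk↔ₛ′ (λ { (() , _) }) (λ ()) (λ ()) (λ { (() , _) }) ; lookup-index = λ { (() , _) } }
concatMap-tabulate-enum {n = suc n} h g eg =
  reindex suc×↔⊎ (λ { (zero , j) → refl ; (suc i , j) → refl })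
          (++-enum (eg (h zero)) (concatMap-tabulate-enum (λ i → h (suc i)) g eg))

AllPairs-resp-⊆ : {R : A → A → Set} {xs ys : List A} → xs ⊆ ys → AllPairs R ys → AllPairs R xs
AllPairs-resp-⊆ []         []         = []
AllPairs-resp-⊆ (_ ∷ʳ τ)   (_ ∷ rys)  = AllPairs-resp-⊆ τ rys
AllPairs-resp-⊆ (refl ∷ τ) (ry ∷ rys) = All-resp-⊆ τ ry ∷ AllPairs-resp-⊆ τ rys

lookup-injective : {xs : List A} → Unique xs → Injective _≡_ _≡_ (lookup xs)
lookup-injective {xs = _ ∷ _} _          {zero}  {zero}  _  = refl
lookup-injective {xs = _ ∷ _} (x∉ ∷ _)   {zero}  {suc j} eq = ⊥-elim (All.lookup x∉ (∈-lookup j) eq)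
lookup-injective {xs = _ ∷ _} (x∉ ∷ _)   {suc i} {zero}  eq = ⊥-elim (All.lookup x∉ (∈-lookup i) (sym eq))
lookup-injective {xs = _ ∷ _} (_ ∷ uxs) {suc i} {suc j} eq = cong suc (lookup-injective uxs eq)

Unique⇒length≤ : {k : ℕ} {xs : List (Fin k)} → Unique xs → length xs ≤ k
Unique⇒length≤ uxs = injective⇒≤ (lookup-injective uxs)

module _ {k : ℕ} (x : Fin k → A) where

  Meets : List A → Set
  Meets xs = ∃ λ j → x j ∈ xs

  private
    witnesses : {xss : List (List A)} → All Meets xss → List (Fin k)
    witnesses = All.reduce proj₁

    length-witnesses : {xss : List (List A)} (ms : All Meets xss) → length (witnesses ms) ≡ length xss
    length-witnesses []       = refl
    length-witnesses (_ ∷ ms) = cong suc (length-witnesses ms)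

    witnesses-unique : {xss : List (List A)} → AllPairs Disjoint xss → (ms : All Meets xss) →
                       Unique (witnesses ms)
    witnesses-unique []         []       = []
    witnesses-unique (ds ∷ dss) (m ∷ ms) = apart m ds ms ∷ witnesses-unique dss ms
      where
        apart : ∀ {xs yss} (m : Meets xs) → All (Disjoint xs) yss → (ms : All Meets yss) →
                All (proj₁ m ≢_) (witnesses ms)
        apart _              []       []                  = []
        apart m@(_ , xj∈xs) (d ∷ ds) ((_ , xj∈ys) ∷ ms) = (λ { refl → d (xj∈xs , xj∈ys) }) ∷ apart m ds ms

  disjoint-meeting-length≤ : {xss : List (List A)} → AllPairs Disjoint xss → All Meets xss → length xss ≤ k
  disjoint-meeting-length≤ dss ms =
    subst (_≤ k) (length-witnesses ms) (Unique⇒length≤ (witnesses-unique dss ms))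


module _ (f : A → B → C) where

  All-zipWith : {P : A → Set} {Q : B → Set} {W : C → Set} → (∀ {a b} → P a → Q b → W (f a b)) →
                {xs : List A} {ys : List B} → All P xs → All Q ys → All W (zipWith f xs ys)
  All-zipWith h []         _          = []
  All-zipWith h (_ ∷ _)    []         = []
  All-zipWith h (pa ∷ pas) (qb ∷ qbs) = h pa qb ∷ All-zipWith h pas qbs

  AllPairs-zipWith : {R : A → A → Set} {S : B → B → Set} {T : C → C → Set} →
                     (∀ {a a′ b b′} → R a a′ → S b b′ → T (f a b) (f a′ b′)) →
                     {xs : List A} {ys : List B} → AllPairs R xs → AllPairs S ys →
                     AllPairs T (zipWith f xs ys)
  AllPairs-zipWith h []         _          = []
  AllPairs-zipWith h (_ ∷ _)    []         = []
  AllPairs-zipWith h (ra ∷ ras) (sb ∷ sbs) = All-zipWith h ra sb ∷ AllPairs-zipWith h ras sbs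

walk-start : {V : Set} {es : EdgeList V} {x y t : V} {is : List (EdgeId es)} →
             x ≡ y → IsWalk es x t is → IsWalk es y t is
walk-start refl w = w

module _ {V : Set} {es : EdgeList V} {f : I → V × V} (en : Enumeration es f) where

  open Enumeration en

  walk-cons-index : ∀ c {x y is} → proj₁ (f c) ≡ x → IsWalk es (proj₂ (f c)) y is →
                    IsWalk es x y (index c ∷ is)
  walk-cons-index c tail≡x w =
    walk-cons (trans (cong proj₁ (lookup-index c)) tail≡x)
              (walk-start (sym (cong proj₂ (lookup-index c))) w)

module NewGraph (n k : ℕ) (E : EdgeList (Fin n)) where

  E′ : EdgeList (NewV n)
  E′ = newEdges n k E

  Label : Set
  Label = EdgeId E ⊎ (Fin n × (Fin k ⊎ Fin k))

  pattern copy i    = inj₁ i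
  pattern exit v j  = inj₂ (v , inj₁ j)
  pattern entry v j = inj₂ (v , inj₂ j)

  ends : Label → NewV n × NewV n
  ends (copy i)    = vout (tail-of E i) , vin (head-of E i)
  ends (exit v j)  = orig v , vout v
  ends (entry v j) = vin v , orig v

  edges : Enumeration E′ ends
  edges = reindex ↔-refl (λ { (copy i) → refl ; (exit v j) → refl ; (entry v j) → refl })
            (++-enum (map-enum _ E)
                     (concatMap-tabulate-enum id _ (λ v → ++-enum (replicate-enum k (orig v , vout v))
                                                                   (replicate-enum k (vin v , orig v)))))

  open Enumeration edges

  head-index : ∀ c → head-of E′ (index c) ≡ proj₂ (ends c)
  head-index c = cong proj₂ (lookup-index c)

  head-label : ∀ {e c} → label e ≡ c → head-of E′ e ≡ proj₂ (ends c)
  head-label {e} refl = cong proj₂ (lookup-label e)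

  lift : Fin k → List (EdgeId E) → List (EdgeId E′)
  lift a []       = []
  lift a (i ∷ is) =
    index (exit (tail-of E i) a) ∷ index (copy i) ∷ index (entry (head-of E i) a) ∷ lift a is

  lift-walk : ∀ a {u t is} → IsWalk E u t is → IsWalk E′ (orig u) (orig t) (lift a is)
  lift-walk a walk-nil           = walk-nil
  lift-walk a (walk-cons refl w) =
    walk-cons-index edges (exit _ a) refl (walk-cons-index edges (copy _) refl
      (walk-cons-index edges (entry _ a) refl (lift-walk a w)))

  copies : Fin n → List (NewV n)
  copies v = vin v ∷ orig v ∷ vout v ∷ []

  owner : NewV n → Fin n
  owner (orig v) = v
  owner (vin v)  = v
  owner (vout v) = v

  ∈-copies⁻ : ∀ {x v} → x ∈ copies v → owner x ≡ v
  ∈-copies⁻ (here refl)                 = refl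
  ∈-copies⁻ (there (here refl))         = refl
  ∈-copies⁻ (there (there (here refl))) = refl

  concatMap-copies-unique : ∀ {vs} → Unique vs → Unique (concatMap copies vs)
  concatMap-copies-unique {vs} uvs =
    Unique.concat⁺ (All.map⁺ (All.universal (λ _ → ((λ ()) ∷ (λ ()) ∷ []) ∷ ((λ ()) ∷ []) ∷ [] ∷ []) vs))
                   (AllPairs.map⁺ (AllPairs.map separated uvs))
    where
      separated : ∀ {v w} → v ≢ w → Disjoint (copies v) (copies w)
      separated v≢w (x∈v , x∈w) = v≢w (trans (sym (∈-copies⁻ x∈v)) (∈-copies⁻ x∈w))

  lift-heads-⊆ : ∀ a {u t is} → IsWalk E u t is →
                 map (head-of E′) (lift a is) ⊆ vout u ∷ concatMap copies (map (head-of E) is)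
  lift-heads-⊆ a walk-nil                   = _ ∷ʳ []
  lift-heads-⊆ a (walk-cons {i = i} refl w) =
    head-index (exit _ a) ∷ head-index (copy i) ∷ head-index (entry _ a) ∷ lift-heads-⊆ a w

  lift-path : ∀ a {u t is} → IsPath E u t is → IsPath E′ (orig u) (orig t) (lift a is)
  lift-path a (w , uvs) =
    lift-walk a w , AllPairs-resp-⊆ (refl ∷ lift-heads-⊆ a w) (AllPairs.tail (concatMap-copies-unique uvs))

  data Lifted (a : Fin k) (is : List (EdgeId E)) : Label → Set where
    copy-of  : ∀ {i} → i ∈ is → Lifted a is (copy i)
    exit-of  : ∀ {v} → Lifted a is (exit v a)
    entry-of : ∀ {v} → Lifted a is (entry v a)

  at-index : ∀ {a is c} → Lifted a is c → Lifted a is (label (index c))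
  at-index {c = c} = subst (Lifted _ _) (sym (label-index c))

  ∈-lift⁻ : ∀ {a is e} → e ∈ lift a is → Lifted a is (label e)
  ∈-lift⁻ {is = _ ∷ _} (here refl)                 = at-index exit-of
  ∈-lift⁻ {is = _ ∷ _} (there (here refl))         = at-index (copy-of (here refl))
  ∈-lift⁻ {is = _ ∷ _} (there (there (here refl))) = at-index entry-of
  ∈-lift⁻ {is = _ ∷ _} {e} (there (there (there e∈))) with label e | ∈-lift⁻ e∈
  ... | _ | copy-of i∈ = copy-of (there i∈)
  ... | _ | exit-of    = exit-of
  ... | _ | entry-of   = entry-of

  lift-disjoint : ∀ {a b is js} → a ≢ b → Disjoint is js → Disjoint (lift a is) (lift b js)
  lift-disjoint {a} {b} {is} {js} a≢b is∩js=∅ (e∈ , e∈′) = apart (∈-lift⁻ e∈) (∈-lift⁻ e∈′)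
    where
      apart : ∀ {c} → Lifted a is c → Lifted b js c → ⊥
      apart (copy-of i∈is) (copy-of i∈js) = is∩js=∅ (i∈is , i∈js)
      apart exit-of        exit-of        = a≢b refl
      apart entry-of       entry-of       = a≢b refl

  lift-family : List (List (EdgeId E)) → List (List (EdgeId E′))
  lift-family = zipWith lift (allFin k)

  length-lift-family : ∀ ps → length (lift-family ps) ≡ k ⊓ length ps
  length-lift-family ps =
    trans (length-zipWith lift (allFin k) ps) (cong (_⊓ length ps) (length-tabulate id))

  lift-family-disjoint-paths : ∀ {s t ps} → EdgeDisjointPaths E s t ps →
                               EdgeDisjointPaths E′ (orig s) (orig t) (lift-family ps)
  lift-family-disjoint-paths (paths , disjoint) =
    All-zipWith lift (λ _ → lift-path _) (All.universal-U _) paths ,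
    AllPairs-zipWith lift lift-disjoint (Unique.allFin⁺ k) disjoint

  keep : Label → List (EdgeId E) → List (EdgeId E)
  keep (copy i) is = i ∷ is
  keep (inj₂ _) is = is

  project : List (EdgeId E′) → List (EdgeId E)
  project []       = []
  project (e ∷ es) = keep (label e) (project es)

  project-∷ : ∀ {e c} es → label e ≡ c → project (e ∷ es) ≡ keep c (project es)
  project-∷ es refl = refl

  ∈-project⁻ : ∀ {i es} → i ∈ project es → index (copy i) ∈ es
  ∈-project⁻ {es = e ∷ es} i∈ with label e | index-label e
  ... | copy j | index≡e with i∈
  ...   | here refl  = here index≡e
  ...   | there i∈′  = there (∈-project⁻ i∈′)
  ∈-project⁻ {es = e ∷ es} i∈ | inj₂ _ | _ = there (∈-project⁻ i∈)

  project-disjoint : ∀ {es fs} → Disjoint es fs → Disjoint (project es) (project fs)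
  project-disjoint es∩fs=∅ (i∈es , i∈fs) = es∩fs=∅ (∈-project⁻ i∈es , ∈-project⁻ i∈fs)

  data Leaving (e : EdgeId E′) : NewV n → Set where
    by-exit  : ∀ v j → label e ≡ exit v j → Leaving e (orig v)
    by-copy  : ∀ i → label e ≡ copy i → Leaving e (vout (tail-of E i))
    by-entry : ∀ v j → label e ≡ entry v j → Leaving e (vin v)

  leaving : ∀ {e x} → tail-of E′ e ≡ x → Leaving e x
  leaving {e} refl = subst (Leaving e) (sym (cong proj₁ (lookup-label e))) (classify (label e) refl)
    where
      classify : ∀ c → label e ≡ c → Leaving e (proj₁ (ends c))
      classify (copy i)    = by-copy i
      classify (exit v j)  = by-exit v j
      classify (entry v j) = by-entry v j

  mutual
    project-from-orig : ∀ {u t es} → IsWalk E′ (orig u) (orig t) es →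
      IsWalk E u t (project es) × map orig (map (head-of E) (project es)) ⊆ map (head-of E′) es
    project-from-orig walk-nil = walk-nil , []
    project-from-orig {es = e ∷ es} (walk-cons tail≡ w) with leaving tail≡
    ... | by-exit _ _ lbl rewrite project-∷ es lbl =
      Product.map₂ (_ ∷ʳ_) (project-from-vout (walk-start (head-label lbl) w))

    project-from-vout : ∀ {u t es} → IsWalk E′ (vout u) (orig t) es →
      IsWalk E u t (project es) × map orig (map (head-of E) (project es)) ⊆ map (head-of E′) es
    project-from-vout {es = e ∷ es} (walk-cons tail≡ w) with leaving tail≡
    ... | by-copy i lbl rewrite project-∷ es lbl =
      Product.map (walk-cons refl) (_ ∷ʳ_) (project-from-vin (walk-start (head-label lbl) w))

    project-from-vin : ∀ {v t es} → IsWalk E′ (vin v) (orig t) es →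
      IsWalk E v t (project es) × orig v ∷ map orig (map (head-of E) (project es)) ⊆ map (head-of E′) es
    project-from-vin {es = e ∷ es} (walk-cons tail≡ w) with leaving tail≡
    ... | by-entry _ _ lbl rewrite project-∷ es lbl =
      Product.map₂ (sym (head-label lbl) ∷_) (project-from-orig (walk-start (head-label lbl) w))

  project-path : ∀ {u t es} → IsPath E′ (orig u) (orig t) es → IsPath E u t (project es)
  project-path (w , uvs) with project-from-orig w
  ... | w′ , τ = w′ , Unique.map⁻ (AllPairs-resp-⊆ (refl ∷ τ) uvs)

  project-disjoint-paths : ∀ {s t ps} → EdgeDisjointPaths E′ (orig s) (orig t) ps →
                           EdgeDisjointPaths E s t (map project ps)
  project-disjoint-paths (paths , disjoint) =
    All.map⁺ (All.map project-path paths) , AllPairs.map⁺ (AllPairs.map project-disjoint disjoint)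

  path-meets-exit : ∀ {s t es} → s ≢ t → IsPath E′ (orig s) (orig t) es →
                    Meets (λ j → index (exit s j)) es
  path-meets-exit s≢t (walk-nil , _) = ⊥-elim (s≢t refl)
  path-meets-exit {es = e ∷ _} _ (walk-cons tail≡ _ , _) with leaving tail≡
  ... | by-exit _ j lbl = j , here (trans (cong index (sym lbl)) (index-label e))

  disjoint-paths-length≤k : ∀ {s t ps} → s ≢ t → EdgeDisjointPaths E′ (orig s) (orig t) ps →
                            length ps ≤ k
  disjoint-paths-length≤k s≢t (paths , disjoint) =
    disjoint-meeting-length≤ _ disjoint (All.map (path-meets-exit s≢t) paths)

lemma20 : (n k : ℕ) → 1 ≤ k → (E : EdgeList (Fin n)) → IsSimple E →
    (s t : Fin n) → ¬ (s ≡ t) → (λst : ℕ) → IsMaxEdgeDisjoint E s t λst →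
    IsMaxEdgeDisjoint (newEdges n k E) (orig s) (orig t) (k ⊓ λst)
lemma20 n k _ E _ s t s≢t _ ((ps , ps-disjoint , refl) , maximal) =
  (lift-family ps , lift-family-disjoint-paths ps-disjoint , length-lift-family ps) ,
  λ qs qs-disjoint → ⊓-glb (disjoint-paths-length≤k s≢t qs-disjoint)
    (subst (_≤ _) (length-map project qs) (maximal _ (project-disjoint-paths qs-disjoint)))
  where open NewGraph n k E
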